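{- Let $n$ be a positive integer. Then $$\tau(n+1)\equiv\begin{cases} R_9\!\left(\frac{n}{3}\right)\pmod 3 & \text{if } 3\mid n,\\ 0\pmod 3 & \text{otherwise.}\end{cases}$$
   Context: $\tau$ is Ramanujan's tau function: $q\prod_{m=1}^{\infty}(1-q^m)^{24}=\sum_{n\geq1}\tau(n)q^n$. $R_9(n)$ is the number of partitions of $n$ with no part divisible by $9$. -}

module Defs where

open import Data.Nat as ℕ using (ℕ; zero; suc; _∸_; _⊓_)
open import Data.Nat.Divisibility using (_∣?_)
open import Data.Integer as ℤ using (ℤ; +_; -_)
open import Data.List using (List; []; _∷_; replicate; _++_; map; concatMap; filter; length; upTo)
open import Data.List.Relation.Unary.All using (all?)
open import Relation.Nullary.Decidable using (¬?)

-- Formal power series / polynomials over ℤ, as coefficient lists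
-- (index i holds the coefficient of q^i).

addP : List ℤ → List ℤ → List ℤ
addP []       ys       = ys
addP xs       []       = xs
addP (x ∷ xs) (y ∷ ys) = (x ℤ.+ y) ∷ addP xs ys

scaleP : ℤ → List ℤ → List ℤ
scaleP c = map (c ℤ.*_)

mulP : List ℤ → List ℤ → List ℤ
mulP []       ys = []
mulP (x ∷ xs) ys = addP (scaleP x ys) (+ 0 ∷ mulP xs ys)

powP : List ℤ → ℕ → List ℤ
powP p zero    = + 1 ∷ []
powP p (suc k) = mulP p (powP p k)

coeff : ℕ → List ℤ → ℤ
coeff _       []       = + 0
coeff zero    (x ∷ xs) = x
coeff (suc i) (x ∷ xs) = coeff i xs

oneMinusQ : ℕ → List ℤ
oneMinusQ zero    = + 0 ∷ []
oneMinusQ (suc m) = + 1 ∷ replicate m (+ 0) ++ (- (+ 1)) ∷ []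

etaProd24 : ℕ → List ℤ
etaProd24 zero    = + 1 ∷ []
etaProd24 (suc N) = mulP (etaProd24 N) (powP (oneMinusQ (suc N)) 24)

-- Ramanujan's tau: q ∏_{m≥1} (1-q^m)^24 = Σ_{n≥1} τ(n) q^n.
-- τ(k+1) is the coefficient of q^k in ∏_{m≥1}(1-q^m)^24, and factors with
-- m > k do not affect that coefficient, so the finite product up to k suffices.
τ : ℕ → ℤ
τ zero    = + 0
τ (suc k) = coeff k (etaProd24 k)

-- Partitions: a partition of n is a non-increasing list of positive
-- integers summing to n.  partitionsBounded f b n lists (each exactly once)
-- the partitions of n all of whose parts are ≤ b, provided the fuel f ≥ n.

partitionsBounded : ℕ → ℕ → ℕ → List (List ℕ)
partitionsBounded _       _ zero    = [] ∷ []
partitionsBounded zero    _ (suc _) = []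
partitionsBounded (suc f) b (suc n) =
  concatMap (λ i → map (suc i ∷_) (partitionsBounded f (suc i) (suc n ∸ suc i)))
            (upTo (b ⊓ suc n))

partitions : ℕ → List (List ℕ)
partitions n = partitionsBounded n n n

R₉ : ℕ → ℕ
R₉ n = length (filter (λ p → all? (λ a → ¬? (9 ∣? a)) p) (partitions n))

-- Write φ(q) = ∏_{m ≥ 1} (1 - q^m), so that q⁻¹ η(q)^24 = φ(q)^24 = ∑ τ(n+1) q^n.
-- Modulo 3, (1 - q^m)^3 ≡ 1 - q^(3m); hence (1 - q^(3m)) (1 - q^m)^24 ≡ (1 - q^m)^27 ≡ 1 - q^(27m),
-- and φ(q)^24 φ(q^3) ≡ φ(q^27). On the other hand ∑ R₉(n) q^n = φ(q^9)/φ(q), so that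
-- φ(q^3) ∑ R₉(n) q^(3n) = φ(q^27) exactly. Cancelling the invertible factor φ(q^3) gives
-- ∑ τ(n+1) q^n ≡ ∑ R₉(n) q^(3n) (mod 3). All of this is done coefficientwise below a degree K,
-- where the infinite products may be truncated.

module Submission where

open import Defs
open import Data.Nat using (ℕ; suc; _≤_; _/_)
open import Data.Nat.Divisibility using () renaming (_∣_ to _∣ℕ_)
open import Data.Integer using (ℤ; +_; _-_)
open import Data.Integer.Divisibility using (_∣_)
open import Data.Product using (_×_)
open import Relation.Nullary using (¬_)

open import Data.Empty using (⊥-elim)
open import Data.Integer as ℤ using (-_)
import Data.Integer.Divisibility.Signed as Signed
import Data.Integer.Properties as ℤₚ
open import Data.Integer.Tactic.RingSolver using (solve-∀)
open import Data.List using (List; []; _∷_; replicate; _++_; map; concatMap; filter; length; upTo)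
import Data.List.Properties as Listₚ
open import Data.List.Relation.Unary.All using (All; []; _∷_; all?)
open import Data.Nat using (zero; _+_; _*_; _<_; _∸_; _⊓_; z≤n; s≤s)
open import Data.Nat.Divisibility using (_∣?_; divides; ∣m+n∣m⇒∣n; ∣m∣n⇒∣m+n; n∣m*n; ∣⇒≤; ∣-refl)
open import Data.Nat.DivMod using (m*n/n≡m; m/n≤m)
open import Data.Nat.ListAction using (sum)
open import Data.Nat.ListAction.Properties using (sum-++)
import Data.Nat.Properties as ℕₚ
open import Data.Product using (_,_)
open import Data.Sum using (inj₁; inj₂)
open import Function using (_∘_; case_of_)
open import Relation.Binary.Bundles using (Setoid)
open import Relation.Binary.PropositionalEquality
import Relation.Binary.Reasoning.Setoid as SetoidReasoning
open import Relation.Nullary using (yes; no; ¬?)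
open import Relation.Unary using (Decidable)

module Congruence (d : ℤ) where

  infix 4 _≡ₘ_
  record _≡ₘ_ (x y : ℤ) : Set where
    constructor ≡ₘ-intro
    field difference-divisible : d Signed.∣ x - y

  ≡ₘ-by : ∀ {x y} q → x - y ≡ q ℤ.* d → x ≡ₘ y
  ≡ₘ-by q eq = ≡ₘ-intro (Signed.divides q eq)

  ≡ₘ-reflexive : ∀ {x y} → x ≡ y → x ≡ₘ y
  ≡ₘ-reflexive {x} refl = ≡ₘ-by (+ 0) (trans (ℤₚ.+-inverseʳ x) (sym (ℤₚ.*-zeroˡ d)))

  ≡ₘ-refl : ∀ {x} → x ≡ₘ x
  ≡ₘ-refl = ≡ₘ-reflexive refl

  ≡ₘ-sym : ∀ {x y} → x ≡ₘ y → y ≡ₘ x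
  ≡ₘ-sym {x} {y} (≡ₘ-intro d∣x-y) =
    ≡ₘ-intro (subst (d Signed.∣_) (negate x y) (Signed.∣m⇒∣-m d∣x-y))
    where
    negate : ∀ x y → - (x - y) ≡ y - x
    negate = solve-∀

  ≡ₘ-trans : ∀ {x y z} → x ≡ₘ y → y ≡ₘ z → x ≡ₘ z
  ≡ₘ-trans {x} {y} {z} (≡ₘ-intro d∣x-y) (≡ₘ-intro d∣y-z) =
    ≡ₘ-intro (subst (d Signed.∣_) (telescope x y z) (Signed.∣m∣n⇒∣m+n d∣x-y d∣y-z))
    where
    telescope : ∀ x y z → (x - y) ℤ.+ (y - z) ≡ x - z
    telescope = solve-∀

  +-cong : ∀ {x x′ y y′} → x ≡ₘ x′ → y ≡ₘ y′ → x ℤ.+ y ≡ₘ x′ ℤ.+ y′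
  +-cong {x} {x′} {y} {y′} (≡ₘ-intro p) (≡ₘ-intro q) =
    ≡ₘ-intro (subst (d Signed.∣_) (regroup x x′ y y′) (Signed.∣m∣n⇒∣m+n p q))
    where
    regroup : ∀ x x′ y y′ → (x - x′) ℤ.+ (y - y′) ≡ (x ℤ.+ y) - (x′ ℤ.+ y′)
    regroup = solve-∀

  minus-cong : ∀ {x x′ y y′} → x ≡ₘ x′ → y ≡ₘ y′ → x - y ≡ₘ x′ - y′
  minus-cong {x} {x′} {y} {y′} (≡ₘ-intro p) (≡ₘ-intro q) =
    ≡ₘ-intro (subst (d Signed.∣_) (regroup x x′ y y′) (Signed.∣m∣n⇒∣m-n p q))
    where
    regroup : ∀ x x′ y y′ → (x - x′) - (y - y′) ≡ (x - y) - (x′ - y′)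
    regroup = solve-∀

  minus-cancelʳ : ∀ {x y s t} → x - s ≡ₘ y - t → s ≡ₘ t → x ≡ₘ y
  minus-cancelʳ {x} {y} {s} {t} x-s≡y-t s≡t = ≡ₘ-trans (≡ₘ-reflexive (sym (restore x s)))
    (≡ₘ-trans (+-cong x-s≡y-t s≡t) (≡ₘ-reflexive (restore y t)))
    where
    restore : ∀ x s → (x - s) ℤ.+ s ≡ x
    restore = solve-∀

  ≡ₘ⇒∣ : ∀ {x y} → x ≡ₘ y → d ∣ x - y
  ≡ₘ⇒∣ (≡ₘ-intro p) = Signed.∣⇒∣ᵤ p

open Congruence (+ 3)

Series : Set
Series = ℕ → ℤ

δ : Series
δ zero    = + 1
δ (suc k) = + 0

shift : ℕ → Series → Series
shift zero    f k       = f k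
shift (suc m) f zero    = + 0
shift (suc m) f (suc k) = shift m f k

infixr 6 [1-q^_]·_ [1-q^_]^_·_

[1-q^_]·_ : ℕ → Series → Series
([1-q^ m ]· f) k = f k - shift m f k

shift-map : (h : ℤ → ℤ) → h (+ 0) ≡ + 0 → ∀ m f → shift m (h ∘ f) ≗ h ∘ shift m f
shift-map h h0 zero    f k       = refl
shift-map h h0 (suc m) f zero    = sym h0
shift-map h h0 (suc m) f (suc k) = shift-map h h0 m f k

shift-zipWith : (_∙_ : ℤ → ℤ → ℤ) → (+ 0) ∙ (+ 0) ≡ + 0 → ∀ m f g →
                shift m (λ j → f j ∙ g j) ≗ λ k → shift m f k ∙ shift m g k
shift-zipWith _∙_ 0∙0 zero    f g k       = refl
shift-zipWith _∙_ 0∙0 (suc m) f g zero    = sym 0∙0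
shift-zipWith _∙_ 0∙0 (suc m) f g (suc k) = shift-zipWith _∙_ 0∙0 m f g k

shift-cong : ∀ m {f g} → f ≗ g → shift m f ≗ shift m g
shift-cong zero    f≗g k       = f≗g k
shift-cong (suc m) f≗g zero    = refl
shift-cong (suc m) f≗g (suc k) = shift-cong m f≗g k

shift-shift : ∀ a b f → shift a (shift b f) ≗ shift (a + b) f
shift-shift zero    b f k       = refl
shift-shift (suc a) b f zero    = refl
shift-shift (suc a) b f (suc k) = shift-shift a b f k

shift-comm : ∀ a b f → shift a (shift b f) ≗ shift b (shift a f)
shift-comm a b f k = begin
  shift a (shift b f) k ≡⟨ shift-shift a b f k ⟩
  shift (a + b) f k     ≡⟨ cong (λ c → shift c f k) (ℕₚ.+-comm a b) ⟩
  shift (b + a) f k     ≡⟨ shift-shift b a f k ⟨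
  shift b (shift a f) k ∎
  where open ≡-Reasoning

shift-below : ∀ m f {k} → k < m → shift m f k ≡ + 0
shift-below (suc m) f {zero}  _         = refl
shift-below (suc m) f {suc k} (s≤s k<m) = shift-below m f k<m

shift-above : ∀ m f {k} → m ≤ k → shift m f k ≡ f (k ∸ m)
shift-above zero    f         _         = refl
shift-above (suc m) f {suc k} (s≤s m≤k) = shift-above m f m≤k

[1-q^]·-cong : ∀ m {f g} → f ≗ g → [1-q^ m ]· f ≗ [1-q^ m ]· g
[1-q^]·-cong m f≗g k = cong₂ _-_ (f≗g k) (shift-cong m f≗g k)

[1-q^]·-comm : ∀ a b f → [1-q^ a ]· [1-q^ b ]· f ≗ [1-q^ b ]· [1-q^ a ]· f
[1-q^]·-comm a b f k = begin
  (f k - shift b f k) - shift a ([1-q^ b ]· f) k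
    ≡⟨ cong (_-_ (f k - shift b f k)) (shift-zipWith _-_ refl a f (shift b f) k) ⟩
  (f k - shift b f k) - (shift a f k - shift a (shift b f) k)
    ≡⟨ cong (λ z → (f k - shift b f k) - (shift a f k - z)) (shift-comm a b f k) ⟩
  (f k - shift b f k) - (shift a f k - shift b (shift a f) k)
    ≡⟨ swap (f k) (shift a f k) (shift b f k) (shift b (shift a f) k) ⟩
  (f k - shift a f k) - (shift b f k - shift b (shift a f) k)
    ≡⟨ cong (_-_ (f k - shift a f k)) (shift-zipWith _-_ refl b f (shift a f) k) ⟨
  (f k - shift a f k) - shift b ([1-q^ a ]· f) k
    ∎
  where
  open ≡-Reasoning
  swap : ∀ x y z w → (x - z) - (y - w) ≡ (x - y) - (z - w)
  swap = solve-∀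

-- Opaque: unfolding (1 - q^m)^27 during conversion checking would duplicate its argument 2^27 times.
opaque
  [1-q^_]^_·_ : ℕ → ℕ → Series → Series
  [1-q^ m ]^ zero  · f = f
  [1-q^ m ]^ suc j · f = [1-q^ m ]· [1-q^ m ]^ j · f

  [1-q^]^-zero : ∀ m f → [1-q^ m ]^ 0 · f ≗ f
  [1-q^]^-zero m f k = refl

  [1-q^]^-suc : ∀ m j f → [1-q^ m ]^ suc j · f ≗ [1-q^ m ]· [1-q^ m ]^ j · f
  [1-q^]^-suc m j f k = refl

  [1-q^]^-one : ∀ m f → [1-q^ m ]^ 1 · f ≗ [1-q^ m ]· f
  [1-q^]^-one m f k = refl

  [1-q^]^-three : ∀ m f → [1-q^ m ]^ 3 · f ≗ [1-q^ m ]· [1-q^ m ]· [1-q^ m ]· f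
  [1-q^]^-three m f k = refl

  [1-q^]^-+ : ∀ m i j f → [1-q^ m ]^ (i + j) · f ≗ [1-q^ m ]^ i · [1-q^ m ]^ j · f
  [1-q^]^-+ m zero    j f k = refl
  [1-q^]^-+ m (suc i) j f k = [1-q^]·-cong m ([1-q^]^-+ m i j f) k

infix 4 _≈[_]_
record _≈[_]_ (f : Series) (K : ℕ) (g : Series) : Set where
  constructor ≈-intro
  field ≈-at : ∀ {k} → k ≤ K → f k ≡ₘ g k
open _≈[_]_ public

≈-setoid : ℕ → Setoid _ _
≈-setoid K = record
  { Carrier       = Series
  ; _≈_           = _≈[ K ]_
  ; isEquivalence = record
    { refl  = ≈-intro λ _ → ≡ₘ-refl
    ; sym   = λ f≈g → ≈-intro λ k≤K → ≡ₘ-sym (≈-at f≈g k≤K)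
    ; trans = λ f≈g g≈h → ≈-intro λ k≤K → ≡ₘ-trans (≈-at f≈g k≤K) (≈-at g≈h k≤K)
    }
  }

module ≈-Reasoning (K : ℕ) = SetoidReasoning (≈-setoid K)

module _ {K : ℕ} where
  open Setoid (≈-setoid K) public using ()
    renaming (refl to ≈-refl; sym to ≈-sym; trans to ≈-trans)

≗⇒≈ : ∀ {K f g} → f ≗ g → f ≈[ K ] g
≗⇒≈ f≗g = ≈-intro λ {k} _ → ≡ₘ-reflexive (f≗g k)

shift-cong-≈ : ∀ m {K f g} → f ≈[ K ] g → shift m f ≈[ K ] shift m g
shift-cong-≈ zero    f≈g = f≈g
shift-cong-≈ (suc m) f≈g = ≈-intro λ
  { {zero}  _     → ≡ₘ-refl
  ; {suc k} k<K → ≈-at (shift-cong-≈ m f≈g) (ℕₚ.<⇒≤ k<K)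
  }

[1-q^]·-cong-≈ : ∀ m {K f g} → f ≈[ K ] g → [1-q^ m ]· f ≈[ K ] [1-q^ m ]· g
[1-q^]·-cong-≈ m f≈g = ≈-intro λ k≤K → minus-cong (≈-at f≈g k≤K) (≈-at (shift-cong-≈ m f≈g) k≤K)

[1-q^]·-≈-id : ∀ m {K} f → K < m → [1-q^ m ]· f ≈[ K ] f
[1-q^]·-≈-id m f K<m = ≈-intro λ {k} k≤K → ≡ₘ-reflexive (begin
  f k - shift m f k ≡⟨ cong (_-_ (f k)) (shift-below m f (ℕₚ.≤-<-trans k≤K K<m)) ⟩
  f k - + 0         ≡⟨ ℤₚ.+-identityʳ (f k) ⟩
  f k               ∎)
  where open ≡-Reasoning

≈-restrict : ∀ {K f g} → f ≈[ suc K ] g → f ≈[ K ] g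
≈-restrict f≈g = ≈-intro λ k≤K → ≈-at f≈g (ℕₚ.m≤n⇒m≤1+n k≤K)

≈-extend : ∀ {K f g} → f ≈[ K ] g → f (suc K) ≡ₘ g (suc K) → f ≈[ suc K ] g
≈-extend {K} f≈g top = ≈-intro λ {k} k≤1+K → case ℕₚ.m≤n⇒m<n∨m≡n k≤1+K of λ
  { (inj₁ (s≤s k≤K)) → ≈-at f≈g k≤K
  ; (inj₂ refl)      → top
  }

-- q^(m+1) f at k only involves f below k, so (1 - q^(m+1)) f determines f coefficient by coefficient.
[1-q^]·-cancel : ∀ m {K f g} → [1-q^ suc m ]· f ≈[ K ] [1-q^ suc m ]· g → f ≈[ K ] g
[1-q^]·-cancel m {zero}  e = ≈-intro λ { z≤n → minus-cancelʳ {s = + 0} {t = + 0} (≈-at e z≤n) ≡ₘ-refl }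
[1-q^]·-cancel m {suc K} e = ≈-extend f≈g
  (minus-cancelʳ (≈-at e ℕₚ.≤-refl) (≈-at (shift-cong-≈ m f≈g) ℕₚ.≤-refl))
  where
  f≈g = [1-q^]·-cancel m (≈-restrict e)

-- (1 - x)^3 = (1 - x^3) + 3 (x^2 - x)
frobenius : ∀ m f {K} → [1-q^ m ]^ 3 · f ≈[ K ] [1-q^ m * 3 ]· f
frobenius m f = ≈-intro λ {k} _ → ≡ₘ-by (s₂ k - s₁ k) (begin
  ([1-q^ m ]^ 3 · f) k - (f k - shift (m * 3) f k)
    ≡⟨ cong₂ _-_ (expand k) (cong (_-_ (f k)) (shift-thrice k)) ⟩
  (((f k - s₁ k) - (s₁ k - s₂ k)) - ((s₁ k - s₂ k) - (s₂ k - s₃ k))) - (f k - s₃ k)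
    ≡⟨ binomial (f k) (s₁ k) (s₂ k) (s₃ k) ⟩
  (s₂ k - s₁ k) ℤ.* + 3
    ∎)
  where
  open ≡-Reasoning
  s₁ s₂ s₃ g : Series
  s₁ = shift m f
  s₂ = shift m s₁
  s₃ = shift m s₂
  g  = [1-q^ m ]· f
  shift-g : shift m g ≗ λ k → s₁ k - s₂ k
  shift-g = shift-zipWith _-_ refl m f s₁
  shift²-g : shift m (shift m g) ≗ λ k → s₂ k - s₃ k
  shift²-g k = trans (shift-cong m shift-g k) (shift-zipWith _-_ refl m s₁ s₂ k)
  expand : ∀ k → ([1-q^ m ]^ 3 · f) k ≡ ((f k - s₁ k) - (s₁ k - s₂ k)) - ((s₁ k - s₂ k) - (s₂ k - s₃ k))
  expand k = begin
    ([1-q^ m ]^ 3 · f) k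
      ≡⟨ [1-q^]^-three m f k ⟩
    ([1-q^ m ]· [1-q^ m ]· g) k
      ≡⟨ cong (_-_ (g k - shift m g k)) (shift-zipWith _-_ refl m g (shift m g) k) ⟩
    (g k - shift m g k) - (shift m g k - shift m (shift m g) k)
      ≡⟨ cong₂ (λ u v → (g k - u) - (u - v)) (shift-g k) (shift²-g k) ⟩
    ((f k - s₁ k) - (s₁ k - s₂ k)) - ((s₁ k - s₂ k) - (s₂ k - s₃ k))
      ∎
  shift-thrice : ∀ k → shift (m * 3) f k ≡ s₃ k
  shift-thrice k = begin
    shift (m * 3) f k           ≡⟨ cong (λ n → shift n f k) (ℕₚ.*-comm m 3) ⟩
    shift (m + (m + (m + 0))) f k ≡⟨ cong (λ n → shift (m + (m + n)) f k) (ℕₚ.+-identityʳ m) ⟩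
    shift (m + (m + m)) f k     ≡⟨ shift-shift m (m + m) f k ⟨
    shift m (shift (m + m) f) k ≡⟨ shift-cong m (λ j → shift-shift m m f j) k ⟨
    s₃ k                        ∎
  binomial : ∀ a b c e → (((a - b) - (b - c)) - ((b - c) - (c - e))) - (a - e) ≡ (c - b) ℤ.* + 3
  binomial = solve-∀

frobenius-pow : ∀ j m f {K} → [1-q^ m ]^ (j * 3) · f ≈[ K ] [1-q^ m * 3 ]^ j · f
frobenius-pow zero    m f = ≗⇒≈ λ k → trans ([1-q^]^-zero m f k) (sym ([1-q^]^-zero (m * 3) f k))
frobenius-pow (suc j) m f = begin
  [1-q^ m ]^ (3 + j * 3) · f             ≈⟨ ≗⇒≈ ([1-q^]^-+ m 3 (j * 3) f) ⟩
  [1-q^ m ]^ 3 · [1-q^ m ]^ (j * 3) · f  ≈⟨ frobenius m ([1-q^ m ]^ (j * 3) · f) ⟩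
  [1-q^ m * 3 ]· [1-q^ m ]^ (j * 3) · f  ≈⟨ [1-q^]·-cong-≈ (m * 3) (frobenius-pow j m f) ⟩
  [1-q^ m * 3 ]· [1-q^ m * 3 ]^ j · f    ≈⟨ ≗⇒≈ ([1-q^]^-suc (m * 3) j f) ⟨
  [1-q^ m * 3 ]^ suc j · f               ∎
  where open ≈-Reasoning _

frobenius-27 : ∀ m f {K} → [1-q^ m ]^ 27 · f ≈[ K ] [1-q^ m * 27 ]· f
frobenius-27 m f = begin
  [1-q^ m ]^ 27 · f               ≈⟨ frobenius-pow 9 m f ⟩
  [1-q^ m * 3 ]^ 9 · f            ≈⟨ frobenius-pow 3 (m * 3) f ⟩
  [1-q^ m * 3 * 3 ]^ 3 · f        ≈⟨ frobenius-pow 1 (m * 3 * 3) f ⟩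
  [1-q^ m * 3 * 3 * 3 ]^ 1 · f    ≈⟨ ≗⇒≈ ([1-q^]^-one (m * 3 * 3 * 3) f) ⟩
  [1-q^ m * 3 * 3 * 3 ]· f        ≡⟨ cong (λ n → [1-q^ n ]· f) m*27 ⟩
  [1-q^ m * 27 ]· f               ∎
  where
  open ≈-Reasoning _
  m*27 : m * 3 * 3 * 3 ≡ m * 27
  m*27 = trans (cong (_* 3) (ℕₚ.*-assoc m 3 3)) (ℕₚ.*-assoc m 9 3)

[1-q^3m]·[1-q^m]^24 : ∀ m f {K} → [1-q^ m * 3 ]· [1-q^ m ]^ 24 · f ≈[ K ] [1-q^ m * 27 ]· f
[1-q^3m]·[1-q^m]^24 m f = begin
  [1-q^ m * 3 ]· [1-q^ m ]^ 24 · f    ≈⟨ frobenius m ([1-q^ m ]^ 24 · f) ⟨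
  [1-q^ m ]^ 3 · [1-q^ m ]^ 24 · f    ≈⟨ ≗⇒≈ ([1-q^]^-+ m 3 24 f) ⟨
  [1-q^ m ]^ 27 · f                   ≈⟨ frobenius-27 m f ⟩
  [1-q^ m * 27 ]· f                   ∎
  where open ≈-Reasoning _

φ : (c N : ℕ) → Series → Series
φ c zero    f = f
φ c (suc N) f = [1-q^ suc N * c ]· φ c N f

φ-cong : ∀ c N {f g} → f ≗ g → φ c N f ≗ φ c N g
φ-cong c zero    f≗g = f≗g
φ-cong c (suc N) f≗g = [1-q^]·-cong (suc N * c) (φ-cong c N f≗g)

φ-[1-q^]-comm : ∀ c N m f → φ c N ([1-q^ m ]· f) ≗ [1-q^ m ]· φ c N f
φ-[1-q^]-comm c zero    m f k = refl
φ-[1-q^]-comm c (suc N) m f k = trans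
  ([1-q^]·-cong (suc N * c) (φ-[1-q^]-comm c N m f) k)
  ([1-q^]·-comm (suc N * c) m (φ c N f) k)

φ-[1-q^]^-comm : ∀ c N m j f → φ c N ([1-q^ m ]^ j · f) ≗ [1-q^ m ]^ j · φ c N f
φ-[1-q^]^-comm c N m zero    f k = trans (φ-cong c N ([1-q^]^-zero m f) k) (sym ([1-q^]^-zero m (φ c N f) k))
φ-[1-q^]^-comm c N m (suc j) f k = begin
  φ c N ([1-q^ m ]^ suc j · f) k          ≡⟨ φ-cong c N ([1-q^]^-suc m j f) k ⟩
  φ c N ([1-q^ m ]· [1-q^ m ]^ j · f) k   ≡⟨ φ-[1-q^]-comm c N m ([1-q^ m ]^ j · f) k ⟩
  ([1-q^ m ]· φ c N ([1-q^ m ]^ j · f)) k ≡⟨ [1-q^]·-cong m (φ-[1-q^]^-comm c N m j f) k ⟩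
  ([1-q^ m ]· [1-q^ m ]^ j · φ c N f) k   ≡⟨ [1-q^]^-suc m j (φ c N f) k ⟨
  ([1-q^ m ]^ suc j · φ c N f) k          ∎
  where open ≡-Reasoning

φ-cancel : ∀ c N {K f g} → φ (suc c) N f ≈[ K ] φ (suc c) N g → f ≈[ K ] g
φ-cancel c zero    e = e
φ-cancel c (suc N) e = φ-cancel c N ([1-q^]·-cancel (c + N * suc c) e)

φ-truncate : ∀ c {N n K} f → K < suc n * c → n ≤ N → φ c N f ≈[ K ] φ c n f
φ-truncate c {N} {n} f K<1+n*c n≤N with ℕₚ.m≤n⇒m<n∨m≡n n≤N
... | inj₂ refl = ≈-refl
φ-truncate c {suc N} f K<1+n*c _ | inj₁ (s≤s n≤N) =
  ≈-trans ([1-q^]·-≈-id (suc N * c) (φ c N f) (ℕₚ.<-≤-trans K<1+n*c (ℕₚ.*-monoˡ-≤ c (s≤s n≤N))))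
          (φ-truncate c f K<1+n*c n≤N)

series : List ℤ → Series
series p k = coeff k p

coeff-addP : ∀ k a b → coeff k (addP a b) ≡ coeff k a ℤ.+ coeff k b
coeff-addP k       []       b        = sym (ℤₚ.+-identityˡ (coeff k b))
coeff-addP k       (x ∷ xs) []       = sym (ℤₚ.+-identityʳ (coeff k (x ∷ xs)))
coeff-addP zero    (x ∷ xs) (y ∷ ys) = refl
coeff-addP (suc k) (x ∷ xs) (y ∷ ys) = coeff-addP k xs ys

coeff-scaleP : ∀ k c a → coeff k (scaleP c a) ≡ c ℤ.* coeff k a
coeff-scaleP k       c []      = sym (ℤₚ.*-zeroʳ c)
coeff-scaleP zero    c (x ∷ a) = refl
coeff-scaleP (suc k) c (x ∷ a) = coeff-scaleP k c a

coeff-mulP-∷ : ∀ x xs B k → coeff k (mulP (x ∷ xs) B) ≡ x ℤ.* coeff k B ℤ.+ shift 1 (series (mulP xs B)) k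
coeff-mulP-∷ x xs B k = trans (coeff-addP k (scaleP x B) (+ 0 ∷ mulP xs B))
  (cong₂ ℤ._+_ (coeff-scaleP k x B) (coeff-0∷ k))
  where
  coeff-0∷ : ∀ k → coeff k (+ 0 ∷ mulP xs B) ≡ shift 1 (series (mulP xs B)) k
  coeff-0∷ zero    = refl
  coeff-0∷ (suc k) = refl

mulP-identityʳ : ∀ A → series (mulP A (+ 1 ∷ [])) ≗ series A
mulP-identityʳ []       k       = refl
mulP-identityʳ (x ∷ xs) zero    = trans (coeff-mulP-∷ x xs (+ 1 ∷ []) 0)
  (trans (ℤₚ.+-identityʳ (x ℤ.* + 1)) (ℤₚ.*-identityʳ x))
mulP-identityʳ (x ∷ xs) (suc k) = trans (coeff-mulP-∷ x xs (+ 1 ∷ []) (suc k))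
  (trans (cong (ℤ._+ coeff k (mulP xs (+ 1 ∷ []))) (ℤₚ.*-zeroʳ x)) (mulP-identityˡ′ k))
  where
  mulP-identityˡ′ : ∀ k → + 0 ℤ.+ coeff k (mulP xs (+ 1 ∷ [])) ≡ coeff k xs
  mulP-identityˡ′ k = trans (ℤₚ.+-identityˡ _) (mulP-identityʳ xs k)

mulP-monomialˡ : ∀ m c B → series (mulP (replicate m (+ 0) ++ c ∷ []) B) ≗ λ k → c ℤ.* shift m (series B) k
mulP-monomialˡ zero c B k = trans (coeff-mulP-∷ c [] B k)
  (trans (cong (ℤ._+_ (c ℤ.* coeff k B)) (shift-map (λ _ → + 0) refl 1 (series B) k)) (ℤₚ.+-identityʳ _))
mulP-monomialˡ (suc m) c B k = trans (coeff-mulP-∷ (+ 0) (replicate m (+ 0) ++ c ∷ []) B k)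
  (trans (ℤₚ.+-identityˡ _) (shifted k))
  where
  shifted : ∀ k → shift 1 (series (mulP (replicate m (+ 0) ++ c ∷ []) B)) k ≡ c ℤ.* shift (suc m) (series B) k
  shifted zero    = sym (ℤₚ.*-zeroʳ c)
  shifted (suc k) = mulP-monomialˡ m c B k

mulP-oneMinusQˡ : ∀ m B → series (mulP (oneMinusQ (suc m)) B) ≗ [1-q^ suc m ]· series B
mulP-oneMinusQˡ m B k = begin
  coeff k (mulP (oneMinusQ (suc m)) B)
    ≡⟨ coeff-mulP-∷ (+ 1) (replicate m (+ 0) ++ - + 1 ∷ []) B k ⟩
  + 1 ℤ.* coeff k B ℤ.+ shift 1 (series (mulP (replicate m (+ 0) ++ - + 1 ∷ []) B)) k
    ≡⟨ cong (ℤ._+_ (+ 1 ℤ.* coeff k B)) (shift-cong 1 (mulP-monomialˡ m (- + 1) B) k) ⟩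
  + 1 ℤ.* coeff k B ℤ.+ shift 1 (λ j → - + 1 ℤ.* shift m (series B) j) k
    ≡⟨ cong (ℤ._+_ (+ 1 ℤ.* coeff k B)) (shift-map (- + 1 ℤ.*_) refl 1 (shift m (series B)) k) ⟩
  + 1 ℤ.* coeff k B ℤ.+ - + 1 ℤ.* shift 1 (shift m (series B)) k
    ≡⟨ cong (λ z → + 1 ℤ.* coeff k B ℤ.+ - + 1 ℤ.* z) (shift-shift 1 m (series B) k) ⟩
  + 1 ℤ.* coeff k B ℤ.+ - + 1 ℤ.* shift (suc m) (series B) k
    ≡⟨ unit-coefficients (coeff k B) (shift (suc m) (series B) k) ⟩
  ([1-q^ suc m ]· series B) k
    ∎
  where
  open ≡-Reasoning
  unit-coefficients : ∀ b s → + 1 ℤ.* b ℤ.+ - + 1 ℤ.* s ≡ b - s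
  unit-coefficients = solve-∀

mulP-[1-q^]ʳ : ∀ m A {B B′} → series B′ ≗ [1-q^ m ]· series B →
               series (mulP A B′) ≗ [1-q^ m ]· series (mulP A B)
mulP-[1-q^]ʳ m []       e k = sym (cong (_-_ (+ 0)) (shift-map (λ _ → + 0) refl m (λ _ → + 0) k))
mulP-[1-q^]ʳ m (x ∷ xs) {B} {B′} e k = begin
  coeff k (mulP (x ∷ xs) B′)
    ≡⟨ coeff-mulP-∷ x xs B′ k ⟩
  x ℤ.* coeff k B′ ℤ.+ shift 1 (series (mulP xs B′)) k
    ≡⟨ cong₂ (λ u v → x ℤ.* u ℤ.+ v) (e k) (shift-cong 1 (mulP-[1-q^]ʳ m xs e) k) ⟩
  x ℤ.* (b - s) ℤ.+ shift 1 ([1-q^ m ]· M) k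
    ≡⟨ cong (ℤ._+_ (x ℤ.* (b - s))) (shift-zipWith _-_ refl 1 M (shift m M) k) ⟩
  x ℤ.* (b - s) ℤ.+ (shift 1 M k - shift 1 (shift m M) k)
    ≡⟨ cong (λ z → x ℤ.* (b - s) ℤ.+ (shift 1 M k - z)) (shift-comm 1 m M k) ⟩
  x ℤ.* (b - s) ℤ.+ (shift 1 M k - shift m (shift 1 M) k)
    ≡⟨ distrib x b s (shift 1 M k) (shift m (shift 1 M) k) ⟩
  (x ℤ.* b ℤ.+ shift 1 M k) - (x ℤ.* s ℤ.+ shift m (shift 1 M) k)
    ≡⟨ cong₂ _-_ (coeff-mulP-∷ x xs B k) shift-coeff ⟨
  coeff k (mulP (x ∷ xs) B) - shift m (series (mulP (x ∷ xs) B)) k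
    ∎
  where
  open ≡-Reasoning
  M = series (mulP xs B)
  b = coeff k B
  s = shift m (series B) k
  shift-coeff : shift m (series (mulP (x ∷ xs) B)) k ≡ x ℤ.* s ℤ.+ shift m (shift 1 M) k
  shift-coeff = begin
    shift m (series (mulP (x ∷ xs) B)) k              ≡⟨ shift-cong m (coeff-mulP-∷ x xs B) k ⟩
    shift m (λ j → x ℤ.* coeff j B ℤ.+ shift 1 M j) k ≡⟨ shift-zipWith ℤ._+_ refl m _ (shift 1 M) k ⟩
    shift m (λ j → x ℤ.* coeff j B) k ℤ.+ shift m (shift 1 M) k
      ≡⟨ cong (ℤ._+ shift m (shift 1 M) k) (shift-map (x ℤ.*_) (ℤₚ.*-zeroʳ x) m (series B) k) ⟩
    x ℤ.* s ℤ.+ shift m (shift 1 M) k                 ∎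
  distrib : ∀ x b s u v → x ℤ.* (b - s) ℤ.+ (u - v) ≡ (x ℤ.* b ℤ.+ u) - (x ℤ.* s ℤ.+ v)
  distrib = solve-∀

mulP-powP-oneMinusQʳ : ∀ m A j → series (mulP A (powP (oneMinusQ (suc m)) j)) ≗ [1-q^ suc m ]^ j · series A
mulP-powP-oneMinusQʳ m A zero    k = trans (mulP-identityʳ A k) (sym ([1-q^]^-zero (suc m) (series A) k))
mulP-powP-oneMinusQʳ m A (suc j) k = begin
  coeff k (mulP A (mulP (oneMinusQ (suc m)) (powP (oneMinusQ (suc m)) j)))
    ≡⟨ mulP-[1-q^]ʳ (suc m) A (mulP-oneMinusQˡ m (powP (oneMinusQ (suc m)) j)) k ⟩
  ([1-q^ suc m ]· series (mulP A (powP (oneMinusQ (suc m)) j))) k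
    ≡⟨ [1-q^]·-cong (suc m) (mulP-powP-oneMinusQʳ m A j) k ⟩
  ([1-q^ suc m ]· [1-q^ suc m ]^ j · series A) k
    ≡⟨ [1-q^]^-suc (suc m) j (series A) k ⟨
  ([1-q^ suc m ]^ suc j · series A) k
    ∎
  where open ≡-Reasoning

η²⁴ : ℕ → Series
η²⁴ N = series (etaProd24 N)

η²⁴-zero : η²⁴ 0 ≗ δ
η²⁴-zero zero    = refl
η²⁴-zero (suc k) = refl

η²⁴-suc : ∀ N → η²⁴ (suc N) ≗ [1-q^ suc N ]^ 24 · η²⁴ N
η²⁴-suc N = mulP-powP-oneMinusQʳ N (etaProd24 N) 24

φ3-η²⁴ : ∀ N {K} → φ 3 N (η²⁴ N) ≈[ K ] φ 27 N δ
φ3-η²⁴ zero        = ≗⇒≈ η²⁴-zero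
φ3-η²⁴ (suc N) {K} = begin
  [1-q^ suc N * 3 ]· φ 3 N (η²⁴ (suc N))
    ≈⟨ ≗⇒≈ ([1-q^]·-cong (suc N * 3) (φ-cong 3 N (η²⁴-suc N))) ⟩
  [1-q^ suc N * 3 ]· φ 3 N ([1-q^ suc N ]^ 24 · η²⁴ N)
    ≈⟨ ≗⇒≈ ([1-q^]·-cong (suc N * 3) (φ-[1-q^]^-comm 3 N (suc N) 24 (η²⁴ N))) ⟩
  [1-q^ suc N * 3 ]· [1-q^ suc N ]^ 24 · φ 3 N (η²⁴ N)
    ≈⟨ [1-q^3m]·[1-q^m]^24 (suc N) (φ 3 N (η²⁴ N)) ⟩
  [1-q^ suc N * 27 ]· φ 3 N (η²⁴ N)
    ≈⟨ [1-q^]·-cong-≈ (suc N * 27) (φ3-η²⁴ N) ⟩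
  [1-q^ suc N * 27 ]· φ 27 N δ
    ∎
  where open ≈-Reasoning K

avoids9? : Decidable (All (λ a → ¬ 9 ∣ℕ a))
avoids9? p = all? (λ a → ¬? (9 ∣? a)) p

boundedR₉ : (f b n : ℕ) → ℕ
boundedR₉ f b n = length (filter avoids9? (partitionsBounded f b n))

unless9∣ : ℕ → ℕ → ℕ
unless9∣ a x with 9 ∣? a
... | yes _ = 0
... | no  _ = x

length-filter-avoids9-map-∷ : ∀ a ys →
  length (filter avoids9? (map (a ∷_) ys)) ≡ unless9∣ a (length (filter avoids9? ys))
length-filter-avoids9-map-∷ a ys with 9 ∣? a
... | yes 9∣a = cong length (Listₚ.filter-none avoids9? (rejected ys))
  where
  rejected : ∀ ys → All (λ p → ¬ All (λ a → ¬ 9 ∣ℕ a) p) (map (a ∷_) ys)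
  rejected []       = []
  rejected (y ∷ ys) = (λ { (9∤a ∷ _) → 9∤a 9∣a }) ∷ rejected ys
... | no  9∤a = trans (cong length (filter-map-∷ ys)) (Listₚ.length-map (a ∷_) (filter avoids9? ys))
  where
  filter-map-∷ : ∀ ys → filter avoids9? (map (a ∷_) ys) ≡ map (a ∷_) (filter avoids9? ys)
  filter-map-∷ []       = refl
  filter-map-∷ (y ∷ ys) = case avoids9? y of λ
    { (yes y-avoids) → begin
        filter avoids9? ((a ∷ y) ∷ map (a ∷_) ys)
          ≡⟨ Listₚ.filter-accept avoids9? {x = a ∷ y} {xs = map (a ∷_) ys} (9∤a ∷ y-avoids) ⟩
        (a ∷ y) ∷ filter avoids9? (map (a ∷_) ys)
          ≡⟨ cong ((a ∷ y) ∷_) (filter-map-∷ ys) ⟩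
        map (a ∷_) (y ∷ filter avoids9? ys)
          ≡⟨ cong (map (a ∷_)) (Listₚ.filter-accept avoids9? {x = y} {xs = ys} y-avoids) ⟨
        map (a ∷_) (filter avoids9? (y ∷ ys))
          ∎
    ; (no y-hits) → begin
        filter avoids9? ((a ∷ y) ∷ map (a ∷_) ys)
          ≡⟨ Listₚ.filter-reject avoids9? {x = a ∷ y} {xs = map (a ∷_) ys} (λ { (_ ∷ y-avoids) → y-hits y-avoids }) ⟩
        filter avoids9? (map (a ∷_) ys)
          ≡⟨ filter-map-∷ ys ⟩
        map (a ∷_) (filter avoids9? ys)
          ≡⟨ cong (map (a ∷_)) (Listₚ.filter-reject avoids9? {x = y} {xs = ys} y-hits) ⟨
        map (a ∷_) (filter avoids9? (y ∷ ys))
          ∎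
    }
    where open ≡-Reasoning

length-filter-concatMap : ∀ {A B : Set} {P : B → Set} (P? : Decidable P) (g : A → List B) xs →
  length (filter P? (concatMap g xs)) ≡ sum (map (length ∘ filter P? ∘ g) xs)
length-filter-concatMap P? g []       = refl
length-filter-concatMap P? g (x ∷ xs) = begin
  length (filter P? (g x ++ concatMap g xs))
    ≡⟨ cong length (Listₚ.filter-++ P? (g x) (concatMap g xs)) ⟩
  length (filter P? (g x) ++ filter P? (concatMap g xs))
    ≡⟨ Listₚ.length-++ (filter P? (g x)) ⟩
  length (filter P? (g x)) + length (filter P? (concatMap g xs))
    ≡⟨ cong (_+_ (length (filter P? (g x)))) (length-filter-concatMap P? g xs) ⟩
  length (filter P? (g x)) + sum (map (length ∘ filter P? ∘ g) xs)
    ∎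
  where open ≡-Reasoning

-- those partitions counted by boundedR₉ (suc f) _ (suc n) whose largest part is suc i
withLargestPart : (f n i : ℕ) → ℕ
withLargestPart f n i = unless9∣ (suc i) (boundedR₉ f (suc i) (n ∸ i))

boundedR₉-suc : ∀ f b n → boundedR₉ (suc f) b (suc n) ≡ sum (map (withLargestPart f n) (upTo (b ⊓ suc n)))
boundedR₉-suc f b n = trans (length-filter-concatMap avoids9? _ (upTo (b ⊓ suc n)))
  (cong sum (Listₚ.map-cong (λ i → length-filter-avoids9-map-∷ (suc i) (partitionsBounded f (suc i) (n ∸ i)))
                            (upTo (b ⊓ suc n))))

boundedR₉-fuel : ∀ {f f′} b n → n ≤ f → n ≤ f′ → boundedR₉ f b n ≡ boundedR₉ f′ b n
boundedR₉-fuel                 b zero    _         _          = refl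
boundedR₉-fuel {suc f} {suc f′} b (suc n) (s≤s n≤f) (s≤s n≤f′) = trans (boundedR₉-suc f b n) (trans
  (cong sum (Listₚ.map-cong (λ i → cong (unless9∣ (suc i)) (boundedR₉-fuel (suc i) (n ∸ i)
              (ℕₚ.≤-trans (ℕₚ.m∸n≤m n i) n≤f) (ℕₚ.≤-trans (ℕₚ.m∸n≤m n i) n≤f′))) (upTo (b ⊓ suc n))))
  (sym (boundedR₉-suc f′ b n)))

boundedR₉-bound : ∀ f {b b′ n} → n ≤ b → n ≤ b′ → boundedR₉ f b n ≡ boundedR₉ f b′ n
boundedR₉-bound f       {n = zero}  _   _    = refl
boundedR₉-bound zero    {n = suc n} _   _    = refl
boundedR₉-bound (suc f) {b} {b′} {suc n} n≤b n≤b′ = begin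
  boundedR₉ (suc f) b (suc n)                          ≡⟨ boundedR₉-suc f b n ⟩
  sum (map (withLargestPart f n) (upTo (b ⊓ suc n)))   ≡⟨ cong (sum ∘ map (withLargestPart f n) ∘ upTo) b⊓1+n≡b′⊓1+n ⟩
  sum (map (withLargestPart f n) (upTo (b′ ⊓ suc n)))  ≡⟨ boundedR₉-suc f b′ n ⟨
  boundedR₉ (suc f) b′ (suc n)                         ∎
  where
  open ≡-Reasoning
  b⊓1+n≡b′⊓1+n = trans (ℕₚ.m≥n⇒m⊓n≡n n≤b) (sym (ℕₚ.m≥n⇒m⊓n≡n n≤b′))

boundedR₉-split : ∀ b k → b ≤ k →
  boundedR₉ (suc k) (suc b) (suc k) ≡ boundedR₉ (suc k) b (suc k) + withLargestPart k k b
boundedR₉-split b k b≤k = begin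
  boundedR₉ (suc k) (suc b) (suc k)     ≡⟨ boundedR₉-suc k (suc b) k ⟩
  sum (map g (upTo (suc b ⊓ suc k)))    ≡⟨ cong (sum ∘ map g) upTo-1+b ⟩
  sum (map g (upTo b ++ b ∷ []))        ≡⟨ cong sum (Listₚ.map-++ g (upTo b) (b ∷ [])) ⟩
  sum (map g (upTo b) ++ g b ∷ [])      ≡⟨ sum-++ (map g (upTo b)) (g b ∷ []) ⟩
  sum (map g (upTo b)) + (g b + 0)      ≡⟨ cong₂ _+_ (cong (sum ∘ map g ∘ upTo) (sym b⊓1+k≡b)) (ℕₚ.+-identityʳ (g b)) ⟩
  sum (map g (upTo (b ⊓ suc k))) + g b  ≡⟨ cong (_+ g b) (boundedR₉-suc k b k) ⟨
  boundedR₉ (suc k) b (suc k) + g b     ∎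
  where
  open ≡-Reasoning
  g = withLargestPart k k
  b⊓1+k≡b : b ⊓ suc k ≡ b
  b⊓1+k≡b = ℕₚ.m≤n⇒m⊓n≡m (ℕₚ.m≤n⇒m≤1+n b≤k)
  upTo-1+b : upTo (suc b ⊓ suc k) ≡ upTo b ++ b ∷ []
  upTo-1+b = trans (cong (upTo ∘ suc) (ℕₚ.m≤n⇒m⊓n≡m b≤k)) (sym (Listₚ.applyUpTo-∷ʳ (λ i → i) b))

-- the generating function ∏_{i ≤ b, 9 ∤ i} (1 - q^i)⁻¹
R₉≤ : ℕ → Series
R₉≤ b k = + boundedR₉ k b k

R₉≤-zero : R₉≤ 0 ≗ δ
R₉≤-zero zero    = refl
R₉≤-zero (suc k) = refl

R₉≤-R₉ : ∀ {b n} → n ≤ b → R₉≤ b n ≡ + R₉ n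
R₉≤-R₉ n≤b = cong +_ (boundedR₉-bound _ n≤b ℕₚ.≤-refl)

R₉≤-suc-9∤ : ∀ b → ¬ 9 ∣ℕ suc b → [1-q^ suc b ]· R₉≤ (suc b) ≗ R₉≤ b
R₉≤-suc-9∤ b 9∤1+b zero    = refl
R₉≤-suc-9∤ b 9∤1+b (suc k) with ℕₚ.≤-<-connex b k
... | inj₁ b≤k = begin
  + boundedR₉ (suc k) (suc b) (suc k) - shift (suc b) (R₉≤ (suc b)) (suc k)
    ≡⟨ cong₂ _-_ (cong +_ (boundedR₉-split b k b≤k)) (shift-above (suc b) (R₉≤ (suc b)) (s≤s b≤k)) ⟩
  + (boundedR₉ (suc k) b (suc k) + withLargestPart k k b) - + boundedR₉ (k ∸ b) (suc b) (k ∸ b)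
    ≡⟨ cong₂ (λ u v → + (boundedR₉ (suc k) b (suc k) + u) - + v) unless9∣-no
             (boundedR₉-fuel (suc b) (k ∸ b) ℕₚ.≤-refl (ℕₚ.m∸n≤m k b)) ⟩
  + (boundedR₉ (suc k) b (suc k) + y) - + y
    ≡⟨ cong (_- + y) (ℤₚ.pos-+ (boundedR₉ (suc k) b (suc k)) y) ⟩
  (+ boundedR₉ (suc k) b (suc k) ℤ.+ + y) - + y
    ≡⟨ cancel (+ boundedR₉ (suc k) b (suc k)) (+ y) ⟩
  + boundedR₉ (suc k) b (suc k)
    ∎
  where
  open ≡-Reasoning
  y = boundedR₉ k (suc b) (k ∸ b)
  unless9∣-no : withLargestPart k k b ≡ y
  unless9∣-no with 9 ∣? suc b
  ... | yes 9∣1+b = ⊥-elim (9∤1+b 9∣1+b)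
  ... | no  _     = refl
  cancel : ∀ x y → (x ℤ.+ y) - y ≡ x
  cancel = solve-∀
... | inj₂ k<b = trans
  (cong₂ _-_ (cong +_ (boundedR₉-bound (suc k) (s≤s (ℕₚ.<⇒≤ k<b)) k<b))
             (shift-below (suc b) (R₉≤ (suc b)) (s≤s k<b)))
  (ℤₚ.+-identityʳ _)

R₉≤-suc-9∣ : ∀ b → 9 ∣ℕ suc b → R₉≤ (suc b) ≗ R₉≤ b
R₉≤-suc-9∣ b 9∣1+b zero    = refl
R₉≤-suc-9∣ b 9∣1+b (suc k) with ℕₚ.≤-<-connex b k
... | inj₁ b≤k = cong +_ (trans (boundedR₉-split b k b≤k)
                                (trans (cong (_+_ (boundedR₉ (suc k) b (suc k))) unless9∣-yes) (ℕₚ.+-identityʳ _)))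
  where
  unless9∣-yes : withLargestPart k k b ≡ 0
  unless9∣-yes with 9 ∣? suc b
  ... | yes _     = refl
  ... | no  9∤1+b = ⊥-elim (9∤1+b 9∣1+b)
... | inj₂ k<b = cong +_ (boundedR₉-bound (suc k) (s≤s (ℕₚ.<⇒≤ k<b)) k<b)

-- inflate₃ f = f(q^3)
inflate₃ : Series → Series
inflate₃ f zero                = f 0
inflate₃ f (suc zero)          = + 0
inflate₃ f (suc (suc zero))    = + 0
inflate₃ f (suc (suc (suc k))) = inflate₃ (f ∘ suc) k

inflate₃-cong : ∀ {f g} → f ≗ g → inflate₃ f ≗ inflate₃ g
inflate₃-cong f≗g zero                = f≗g 0
inflate₃-cong f≗g (suc zero)          = refl
inflate₃-cong f≗g (suc (suc zero))    = refl
inflate₃-cong f≗g (suc (suc (suc k))) = inflate₃-cong (f≗g ∘ suc) k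

inflate₃-zipWith : (_∙_ : ℤ → ℤ → ℤ) → (+ 0) ∙ (+ 0) ≡ + 0 → ∀ f g →
                   inflate₃ (λ j → f j ∙ g j) ≗ λ k → inflate₃ f k ∙ inflate₃ g k
inflate₃-zipWith _∙_ 0∙0 f g zero                = refl
inflate₃-zipWith _∙_ 0∙0 f g (suc zero)          = sym 0∙0
inflate₃-zipWith _∙_ 0∙0 f g (suc (suc zero))    = sym 0∙0
inflate₃-zipWith _∙_ 0∙0 f g (suc (suc (suc k))) = inflate₃-zipWith _∙_ 0∙0 (f ∘ suc) (g ∘ suc) k

inflate₃-shift : ∀ m f → inflate₃ (shift m f) ≗ shift (m * 3) (inflate₃ f)
inflate₃-shift zero    f k                   = refl
inflate₃-shift (suc m) f zero                = refl
inflate₃-shift (suc m) f (suc zero)          = refl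
inflate₃-shift (suc m) f (suc (suc zero))    = refl
inflate₃-shift (suc m) f (suc (suc (suc k))) = inflate₃-shift m f k

inflate₃-[1-q^] : ∀ m f → inflate₃ ([1-q^ m ]· f) ≗ [1-q^ m * 3 ]· inflate₃ f
inflate₃-[1-q^] m f k =
  trans (inflate₃-zipWith _-_ refl f (shift m f) k) (cong (_-_ (inflate₃ f k)) (inflate₃-shift m f k))

inflate₃-δ : inflate₃ δ ≗ δ
inflate₃-δ zero                = refl
inflate₃-δ (suc zero)          = refl
inflate₃-δ (suc (suc zero))    = refl
inflate₃-δ (suc (suc (suc k))) = inflate₃-zero k
  where
  inflate₃-zero : ∀ k → inflate₃ (λ _ → + 0) k ≡ + 0
  inflate₃-zero zero                = refl
  inflate₃-zero (suc zero)          = refl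
  inflate₃-zero (suc (suc zero))    = refl
  inflate₃-zero (suc (suc (suc k))) = inflate₃-zero k

inflate₃-*3 : ∀ f q → inflate₃ f (q * 3) ≡ f q
inflate₃-*3 f zero    = refl
inflate₃-*3 f (suc q) = inflate₃-*3 (f ∘ suc) q

inflate₃-divisible : ∀ f {n} → 3 ∣ℕ n → inflate₃ f n ≡ f (n / 3)
inflate₃-divisible f (divides q refl) = trans (inflate₃-*3 f q) (cong f (sym (m*n/n≡m q 3)))

inflate₃-indivisible : ∀ f {n} → ¬ 3 ∣ℕ n → inflate₃ f n ≡ + 0
inflate₃-indivisible f {zero}                3∤0   = ⊥-elim (3∤0 (divides 0 refl))
inflate₃-indivisible f {suc zero}            _     = refl
inflate₃-indivisible f {suc (suc zero)}      _     = refl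
inflate₃-indivisible f {suc (suc (suc n))}   3∤3+n = inflate₃-indivisible (f ∘ suc) (3∤3+n ∘ ∣m∣n⇒∣m+n ∣-refl)

φ3-inflate₃-R₉≤-suc-9∤ : ∀ b → ¬ 9 ∣ℕ suc b →
  φ 3 (suc b) (inflate₃ (R₉≤ (suc b))) ≗ φ 3 b (inflate₃ (R₉≤ b))
φ3-inflate₃-R₉≤-suc-9∤ b 9∤1+b k = begin
  ([1-q^ suc b * 3 ]· φ 3 b (inflate₃ (R₉≤ (suc b)))) k ≡⟨ φ-[1-q^]-comm 3 b (suc b * 3) _ k ⟨
  φ 3 b ([1-q^ suc b * 3 ]· inflate₃ (R₉≤ (suc b))) k   ≡⟨ φ-cong 3 b (inflate₃-[1-q^] (suc b) _) k ⟨
  φ 3 b (inflate₃ ([1-q^ suc b ]· R₉≤ (suc b))) k       ≡⟨ φ-cong 3 b (inflate₃-cong (R₉≤-suc-9∤ b 9∤1+b)) k ⟩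
  φ 3 b (inflate₃ (R₉≤ b)) k                            ∎
  where open ≡-Reasoning

φ3-inflate₃-R₉≤-suc-9∣ : ∀ b → 9 ∣ℕ suc b →
  φ 3 (suc b) (inflate₃ (R₉≤ (suc b))) ≗ [1-q^ suc b * 3 ]· φ 3 b (inflate₃ (R₉≤ b))
φ3-inflate₃-R₉≤-suc-9∣ b 9∣1+b = [1-q^]·-cong (suc b * 3) (φ-cong 3 b (inflate₃-cong (R₉≤-suc-9∣ b 9∣1+b)))

-- Of the factors 1 - q^(3i) of φ(q^3), those with 9 ∤ i cancel against R₉≤(q^3); the rest form φ(q^27).
φ3-inflate₃-R₉≤ : ∀ c → φ 3 (c * 9) (inflate₃ (R₉≤ (c * 9))) ≗ φ 27 c δ
φ3-inflate₃-R₉≤ zero    k = trans (inflate₃-cong R₉≤-zero k) (inflate₃-δ k)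
φ3-inflate₃-R₉≤ (suc c) k = begin
  φ 3 (suc (8 + c * 9)) (G (suc (8 + c * 9))) k     ≡⟨ φ3-inflate₃-R₉≤-suc-9∣ (8 + c * 9) (n∣m*n (suc c)) k ⟩
  ([1-q^ suc c * 9 * 3 ]· φ 3 (8 + c * 9) (G (8 + c * 9))) k
    ≡⟨ [1-q^]·-cong (suc c * 9 * 3) (λ j → trans (below-multiple 8 ℕₚ.≤-refl j) (φ3-inflate₃-R₉≤ c j)) k ⟩
  ([1-q^ suc c * 9 * 3 ]· φ 27 c δ) k
    ≡⟨ cong (λ n → ([1-q^ n ]· φ 27 c δ) k) (ℕₚ.*-assoc (suc c) 9 3) ⟩
  φ 27 (suc c) δ k
    ∎
  where
  open ≡-Reasoning
  G : ℕ → Series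
  G b = inflate₃ (R₉≤ b)
  below-multiple : ∀ r → r ≤ 8 → φ 3 (r + c * 9) (G (r + c * 9)) ≗ φ 3 (c * 9) (G (c * 9))
  below-multiple zero    _       = λ _ → refl
  below-multiple (suc r) 1+r≤8 j = trans
    (φ3-inflate₃-R₉≤-suc-9∤ (r + c * 9) 9∤1+r+c*9 j) (below-multiple r (ℕₚ.<⇒≤ 1+r≤8) j)
    where
    9∤1+r+c*9 : ¬ 9 ∣ℕ suc r + c * 9
    9∤1+r+c*9 9∣ = ℕₚ.<⇒≱ (s≤s 1+r≤8)
      (∣⇒≤ (∣m+n∣m⇒∣n (subst (9 ∣ℕ_) (ℕₚ.+-comm (suc r) (c * 9)) 9∣) (n∣m*n c)))

τ≡inflate₃-R₉≤ : ∀ n → τ (suc n) ≡ₘ inflate₃ (R₉≤ (n * 9)) n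
τ≡inflate₃-R₉≤ n = ≈-at (φ-cancel 2 n (begin
  φ 3 n (η²⁴ n)                                  ≈⟨ φ3-η²⁴ n ⟩
  φ 27 n δ                                       ≈⟨ ≗⇒≈ (φ3-inflate₃-R₉≤ n) ⟨
  φ 3 (n * 9) (inflate₃ (R₉≤ (n * 9)))           ≈⟨ φ-truncate 3 _ n<1+n*3 (ℕₚ.m≤m*n n 9) ⟩
  φ 3 n (inflate₃ (R₉≤ (n * 9)))                 ∎)) ℕₚ.≤-refl
  where
  open ≈-Reasoning n
  n<1+n*3 : n < suc n * 3
  n<1+n*3 = s≤s (ℕₚ.≤-trans (ℕₚ.m≤m*n n 3) (ℕₚ.m≤n+m (n * 3) 2))

mainTheorem9 : (n : ℕ) → 1 ≤ n →
    (3 ∣ℕ n → (+ 3) ∣ (τ (suc n) - + R₉ (n / 3)))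
    × (¬ (3 ∣ℕ n) → (+ 3) ∣ τ (suc n))
mainTheorem9 n _ = divisible , indivisible
  where
  divisible : 3 ∣ℕ n → + 3 ∣ τ (suc n) - + R₉ (n / 3)
  divisible 3∣n = ≡ₘ⇒∣ (≡ₘ-trans (τ≡inflate₃-R₉≤ n) (≡ₘ-reflexive (begin
    inflate₃ (R₉≤ (n * 9)) n   ≡⟨ inflate₃-divisible (R₉≤ (n * 9)) 3∣n ⟩
    R₉≤ (n * 9) (n / 3)        ≡⟨ R₉≤-R₉ (ℕₚ.≤-trans (m/n≤m n 3) (ℕₚ.m≤m*n n 9)) ⟩
    + R₉ (n / 3)               ∎)))
    where open ≡-Reasoning
  indivisible : ¬ 3 ∣ℕ n → + 3 ∣ τ (suc n)
  indivisible 3∤n = subst (+ 3 ∣_) (ℤₚ.+-identityʳ (τ (suc n)))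
    (≡ₘ⇒∣ (≡ₘ-trans (τ≡inflate₃-R₉≤ n) (≡ₘ-reflexive (inflate₃-indivisible _ 3∤n))))
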